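{- Let $H$ and $G$ be finite permutation groups on the same set, both acting $2$-transitively, with $H$ a proper subgroup of $G$. Then there exist derangements in $G$ that are not in $H$.
   Context: A derangement is an element with no fixed point. -}

module Defs where

open import Data.Nat using (ℕ)
open import Data.Fin using (Fin)
open import Data.Fin.Permutation using (Permutation′; _⟨$⟩ʳ_; _≈_; id; flip; _∘ₚ_)
open import Data.Product using (Σ; ∃; _×_; _,_)
open import Relation.Binary.PropositionalEquality using (_≡_; _≢_)
open import Relation.Nullary using (¬_; Dec)

-- A permutation group on the finite set Fin n: a subset of Sym(Fin n)
-- (given as a predicate, respecting pointwise equality of permutations,
-- with decidable membership since it is a finite subset) containing the
-- identity and closed under composition and inverses.
record PermGroup (n : ℕ) : Set₁ where
  field
    _∈G : Permutation′ n → Set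
    ∈-dec  : ∀ g → Dec (g ∈G)
    ∈-resp : ∀ {g h} → g ≈ h → g ∈G → h ∈G
    id-∈   : id ∈G
    ∘-∈    : ∀ {g h} → g ∈G → h ∈G → (g ∘ₚ h) ∈G
    inv-∈  : ∀ {g} → g ∈G → flip g ∈G

open PermGroup public

_∈_ : ∀ {n} → Permutation′ n → PermGroup n → Set
g ∈ G = _∈G G g

_∉_ : ∀ {n} → Permutation′ n → PermGroup n → Set
g ∉ G = ¬ (g ∈ G)

_⊆_ : ∀ {n} → PermGroup n → PermGroup n → Set
H ⊆ G = ∀ g → g ∈ H → g ∈ G

_⊂_ : ∀ {n} → PermGroup n → PermGroup n → Set
H ⊂ G = H ⊆ G × ∃ λ g → g ∈ G × g ∉ H

TwoTransitive : ∀ {n} → PermGroup n → Set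
TwoTransitive {n} G =
  ∀ (a b c d : Fin n) → a ≢ b → c ≢ d →
  ∃ λ g → g ∈ G × (g ⟨$⟩ʳ a ≡ c) × (g ⟨$⟩ʳ b ≡ d)

Derangement : ∀ {n} → Permutation′ n → Set
Derangement {n} g = ∀ (x : Fin n) → g ⟨$⟩ʳ x ≢ x

module Submission where

-- For a permutation g of Fin n let fix g be its number of fixed points and
-- fix₂ g its number of ordered pairs of distinct fixed points; write
-- ∑⟨ 𝟙∈ K ⟩ F for the sum of F over the elements of a group K and |K| for
-- its order.  Sums over K are invariant under left translation by elements
-- of K, so for a 2-transitive K counting fixed points and fixed pairs orbit
-- by orbit gives
--     ∑⟨ 𝟙∈ K ⟩ fix ≡ |K|   and   ∑⟨ 𝟙∈ K ⟩ fix₂ ≡ |K|.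
-- Subtracting the identities for H from those for G (H ⊆ G), both also hold
-- for the set S = G ∖ H.  If S had no derangement, fix ≥ 1 on S together
-- with ∑⟨ 𝟙S ⟩ fix ≡ |S| forces fix ≡ 1 on S, hence fix₂ = fix² - fix ≡ 0
-- on S and |S| = ∑⟨ 𝟙S ⟩ fix₂ ≡ 0, contradicting S ≠ ∅.

open import Defs
open import Data.Bool using (if_then_else_)
open import Data.Empty using (⊥-elim)
open import Data.Fin using (Fin; zero; suc; punchIn)
open import Data.Fin.Permutation
  using (Permutation′; _⟨$⟩ʳ_; _⟨$⟩ˡ_; _≈_; id; flip; _∘ₚ_; insert; remove;
         insert-punchIn; punchIn-permute; inverseˡ; inverseʳ)
open import Data.Fin.Properties using (_≟_; all?; punchIn-injective)
open import Data.Nat using (ℕ; zero; suc; _+_; _*_; _∸_; _≤_; z≤n)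
open import Data.Nat.Properties
  using (+-identityʳ; *-identityʳ; +-cancelʳ-≡; *-zeroʳ; *-comm; *-distribʳ-+;
         +-cancelˡ-≡; ≤-refl; ≤-reflexive; ≤-antisym;
         +-mono-≤; n≤0⇒n≡0; m∸n≡0⇒m≤n; m+[n∸m]≡n; m+n≡0⇒m≡0; m+n≡0⇒n≡0;
         n≢0⇒n>0; +-*-semiring; *-commutativeSemigroup)
  renaming (_≟_ to _≟ℕ_)
open import Data.Product using (∃; _×_; _,_)
open import Data.Sum using (_⊎_; inj₁; inj₂)
open import Function using (_⇔_; mk⇔; Equivalence)
open import Relation.Binary.Core using (_Preserves_⟶_)
open import Relation.Binary.Definitions using (_Respects_)
open import Relation.Binary.PropositionalEquality
open import Relation.Nullary using (Dec; yes; no; does; ¬_; ¬?; _×-dec_)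
open import Relation.Unary using (Decidable)
open import Algebra.Properties.Semiring.Sum +-*-semiring
  using (sum; sum-syntax; sum-cong-≗; sum-replicate-zero; *-distribʳ-sum; ∑-distrib-+; ∑-comm; *-distribˡ-sum)
open import Algebra.Properties.CommutativeSemigroup *-commutativeSemigroup
  using (x∙yz≈y∙xz; x∙yz≈z∙xy)

-- 𝟙 d is 1 if the decided proposition holds and 0 otherwise.  Defining it
-- through 'does' makes it compute through 'map′' (e.g. for 'suc x ≟ suc y').
𝟙 : {A : Set} → Dec A → ℕ
𝟙 d = if does d then 1 else 0

𝟙-cong : {A B : Set} (p : Dec A) (q : Dec B) → (A → B) → (B → A) → 𝟙 p ≡ 𝟙 q
𝟙-cong (yes _) (yes _) f g = refl
𝟙-cong (yes a) (no ¬b) f g = ⊥-elim (¬b (f a))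
𝟙-cong (no ¬a) (yes b) f g = ⊥-elim (¬a (g b))
𝟙-cong (no _)  (no _)  f g = refl

𝟙-yes : {A : Set} → A → (d : Dec A) → 𝟙 d ≡ 1
𝟙-yes a (yes _) = refl
𝟙-yes a (no ¬a) = ⊥-elim (¬a a)

𝟙≢0⇒ : {A : Set} (d : Dec A) → 𝟙 d ≢ 0 → A
𝟙≢0⇒ (yes a) _ = a
𝟙≢0⇒ (no _)  e = ⊥-elim (e refl)

𝟙≡0⇒¬ : {A : Set} (d : Dec A) → 𝟙 d ≡ 0 → ¬ A
𝟙≡0⇒¬ (yes a) ()
𝟙≡0⇒¬ (no ¬a) _ = ¬a

𝟙-× : {A B : Set} (p : Dec A) (q : Dec B) → 𝟙 (p ×-dec q) ≡ 𝟙 p * 𝟙 q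
𝟙-× (yes _) (yes _) = refl
𝟙-× (yes _) (no _)  = refl
𝟙-× (no _)  _       = refl

𝟙-idem : {A : Set} (d : Dec A) → 𝟙 d * 𝟙 d ≡ 𝟙 d
𝟙-idem (yes _) = refl
𝟙-idem (no _)  = refl

𝟙-split : {A : Set} (d : Dec A) (m : ℕ) → 𝟙 (¬? d) * m + 𝟙 d * m ≡ m
𝟙-split (yes _) m = +-identityʳ m
𝟙-split (no _)  m = trans (+-identityʳ _) (+-identityʳ m)

𝟙*-≤ : {A : Set} (d : Dec A) (m : ℕ) → 𝟙 d * m ≤ m
𝟙*-≤ (yes _) m = ≤-reflexive (+-identityʳ m)
𝟙*-≤ (no _)  m = z≤n

𝟙-guard : {A : Set} (d : Dec A) {m k : ℕ} → (A → m ≡ k) → 𝟙 d * m ≡ 𝟙 d * k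
𝟙-guard (yes a) e = cong (_+ 0) (e a)
𝟙-guard (no _)  e = refl

𝟙-guard-≤ : {A : Set} (d : Dec A) {m k : ℕ} → (A → m ≤ k) → 𝟙 d * m ≤ 𝟙 d * k
𝟙-guard-≤ (yes a) le = +-mono-≤ (le a) ≤-refl
𝟙-guard-≤ (no _)  le = z≤n

𝟙-cancel : {A : Set} (d : Dec A) {m k : ℕ} → A → 𝟙 d * m ≡ 𝟙 d * k → m ≡ k
𝟙-cancel (yes _) _ e = trans (sym (+-identityʳ _)) (trans e (+-identityʳ _))
𝟙-cancel (no ¬a) a _ = ⊥-elim (¬a a)

∑-δ : ∀ {n} (x : Fin n) (f : Fin n → ℕ) → ∑[ j < n ] (𝟙 (x ≟ j) * f j) ≡ f x
∑-δ {suc n} zero    f =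
  -- the remaining terms vanish because zero ≢ suc j
  trans (cong (f zero + 0 +_) (sum-replicate-zero n))
        (trans (+-identityʳ _) (+-identityʳ (f zero)))
∑-δ {suc n} (suc x) f = ∑-δ x (λ j → f (suc j))

∑-δ₁ : ∀ {n} (x : Fin n) → ∑[ j < n ] 𝟙 (x ≟ j) ≡ 1
∑-δ₁ {n} x = trans (sum-cong-≗ (λ j → sym (*-identityʳ (𝟙 (x ≟ j))))) (∑-δ x (λ _ → 1))

∑-mono : ∀ {n} {f g : Fin n → ℕ} → (∀ i → f i ≤ g i) → sum f ≤ sum g
∑-mono {zero}  le = z≤n
∑-mono {suc n} le = +-mono-≤ (le zero) (∑-mono (λ i → le (suc i)))

∑≡0⇒ : ∀ {n} (f : Fin n → ℕ) → sum f ≡ 0 → ∀ i → f i ≡ 0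
∑≡0⇒ f e zero    = m+n≡0⇒m≡0 (f zero) e
∑≡0⇒ f e (suc i) = ∑≡0⇒ (λ j → f (suc j)) (m+n≡0⇒n≡0 (f zero) e) i

∑≢0⇒ : ∀ {n} (f : Fin n → ℕ) → sum f ≢ 0 → ∃ λ i → f i ≢ 0
∑≢0⇒ {zero}  f ne = ⊥-elim (ne refl)
∑≢0⇒ {suc n} f ne with f zero ≟ℕ 0
... | no f₀≢0 = zero , f₀≢0
... | yes f₀≡0 with ∑≢0⇒ (λ i → f (suc i)) (λ e → ne (cong₂ _+_ f₀≡0 e))
...   | i , fᵢ≢0 = suc i , fᵢ≢0

∑-distinct-pair : ∀ {n} {p q : Fin n} → p ≢ q →
  ∑[ x < n ] ∑[ y < n ] (𝟙 (¬? (x ≟ y)) * (𝟙 (p ≟ x) * 𝟙 (q ≟ y))) ≡ 1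
∑-distinct-pair {n} {p} {q} p≢q = begin
  ∑[ x < n ] ∑[ y < n ] (𝟙 (¬? (x ≟ y)) * (𝟙 (p ≟ x) * 𝟙 (q ≟ y)))
    ≡⟨ sum-cong-≗ (λ x → sum-cong-≗ (λ y → x∙yz≈z∙xy (𝟙 (¬? (x ≟ y))) (𝟙 (p ≟ x)) _)) ⟩
  ∑[ x < n ] ∑[ y < n ] (𝟙 (q ≟ y) * (𝟙 (¬? (x ≟ y)) * 𝟙 (p ≟ x)))
    ≡⟨ sum-cong-≗ (λ x → ∑-δ q (λ y → 𝟙 (¬? (x ≟ y)) * 𝟙 (p ≟ x))) ⟩
  ∑[ x < n ] (𝟙 (¬? (x ≟ q)) * 𝟙 (p ≟ x))
    ≡⟨ sum-cong-≗ (λ x → *-comm (𝟙 (¬? (x ≟ q))) (𝟙 (p ≟ x))) ⟩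
  ∑[ x < n ] (𝟙 (p ≟ x) * 𝟙 (¬? (x ≟ q)))
    ≡⟨ ∑-δ p (λ x → 𝟙 (¬? (x ≟ q))) ⟩
  𝟙 (¬? (p ≟ q))
    ≡⟨ 𝟙-yes p≢q (¬? (p ≟ q)) ⟩
  1 ∎
  where open ≡-Reasoning

Perm : ℕ → Set
Perm = Permutation′

≈-sym : ∀ {n} {p q : Perm n} → p ≈ q → q ≈ p
≈-sym e i = sym (e i)

infix 4 _≈?_
_≈?_ : ∀ {n} (p q : Perm n) → Dec (p ≈ q)
p ≈? q = all? (λ i → p ⟨$⟩ʳ i ≟ q ⟨$⟩ʳ i)

extend : ∀ {m} → Fin (suc m) → Perm m → Perm (suc m)
extend j ρ = insert zero j ρ

extend-unique : ∀ {m} (p : Perm (suc m)) j ρ →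
  p ≈ extend j ρ ⇔ (p ⟨$⟩ʳ zero ≡ j × remove zero p ≈ ρ)
extend-unique p j ρ = mk⇔ to from
  where
  open ≡-Reasoning
  to : p ≈ extend j ρ → p ⟨$⟩ʳ zero ≡ j × remove zero p ≈ ρ
  to e = e zero , λ k → punchIn-injective j _ _ (begin
    punchIn j (remove zero p ⟨$⟩ʳ k)               ≡⟨ cong (λ z → punchIn z _) (sym (e zero)) ⟩
    punchIn (p ⟨$⟩ʳ zero) (remove zero p ⟨$⟩ʳ k)   ≡⟨ sym (punchIn-permute p zero k) ⟩
    p ⟨$⟩ʳ suc k                                   ≡⟨ e (suc k) ⟩
    extend j ρ ⟨$⟩ʳ suc k                          ≡⟨ insert-punchIn zero j ρ k ⟩
    punchIn j (ρ ⟨$⟩ʳ k)                           ∎)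
  from : p ⟨$⟩ʳ zero ≡ j × remove zero p ≈ ρ → p ≈ extend j ρ
  from (e , r) zero    = e
  from (e , r) (suc k) = begin
    p ⟨$⟩ʳ suc k                                   ≡⟨ punchIn-permute p zero k ⟩
    punchIn (p ⟨$⟩ʳ zero) (remove zero p ⟨$⟩ʳ k)   ≡⟨ cong₂ punchIn e (r k) ⟩
    punchIn j (ρ ⟨$⟩ʳ k)                           ≡⟨ sym (insert-punchIn zero j ρ k) ⟩
    extend j ρ ⟨$⟩ʳ suc k                          ∎

-- ∑ₚ F sums F over Sym(n), enumerated through the decomposition above.
∑ₚ : ∀ {n} → (Perm n → ℕ) → ℕ
∑ₚ {zero}  F = F id
∑ₚ {suc m} F = ∑[ j < suc m ] ∑ₚ (λ ρ → F (extend j ρ))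

∑ₚ-cong : ∀ {n} {F F′ : Perm n → ℕ} → (∀ p → F p ≡ F′ p) → ∑ₚ F ≡ ∑ₚ F′
∑ₚ-cong {zero}  e = e id
∑ₚ-cong {suc m} e = sum-cong-≗ (λ j → ∑ₚ-cong (λ ρ → e (extend j ρ)))

∑ₚ-+ : ∀ {n} (F F′ : Perm n → ℕ) → ∑ₚ (λ p → F p + F′ p) ≡ ∑ₚ F + ∑ₚ F′
∑ₚ-+ {zero}  F F′ = refl
∑ₚ-+ {suc m} F F′ =
  trans (sum-cong-≗ (λ j → ∑ₚ-+ (λ ρ → F (extend j ρ)) (λ ρ → F′ (extend j ρ))))
        (∑-distrib-+ (λ j → ∑ₚ (λ ρ → F (extend j ρ))) (λ j → ∑ₚ (λ ρ → F′ (extend j ρ))))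

∑ₚ-*ˡ : ∀ {n} (c : ℕ) (F : Perm n → ℕ) → ∑ₚ (λ p → c * F p) ≡ c * ∑ₚ F
∑ₚ-*ˡ {zero}  c F = refl
∑ₚ-*ˡ {suc m} c F =
  trans (sum-cong-≗ (λ j → ∑ₚ-*ˡ c (λ ρ → F (extend j ρ))))
        (sym (*-distribˡ-sum c (λ j → ∑ₚ (λ ρ → F (extend j ρ)))))

∑ₚ-∑ : ∀ {n k} (M : Perm n → Fin k → ℕ) →
  ∑ₚ (λ p → ∑[ x < k ] M p x) ≡ ∑[ x < k ] ∑ₚ (λ p → M p x)
∑ₚ-∑ {zero}  M = refl
∑ₚ-∑ {suc m} M =
  trans (sum-cong-≗ (λ j → ∑ₚ-∑ (λ ρ → M (extend j ρ))))
        (∑-comm (λ j x → ∑ₚ (λ ρ → M (extend j ρ) x)))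

∑ₚ-comm : ∀ {n k} (M : Perm n → Perm k → ℕ) →
  ∑ₚ (λ p → ∑ₚ (λ q → M p q)) ≡ ∑ₚ (λ q → ∑ₚ (λ p → M p q))
∑ₚ-comm {zero}  M = refl
∑ₚ-comm {suc m} M =
  trans (sum-cong-≗ (λ j → ∑ₚ-comm (λ ρ → M (extend j ρ))))
        (sym (∑ₚ-∑ (λ q j → ∑ₚ (λ ρ → M (extend j ρ) q))))

∑ₚ-mono : ∀ {n} {F F′ : Perm n → ℕ} → (∀ p → F p ≤ F′ p) → ∑ₚ F ≤ ∑ₚ F′
∑ₚ-mono {zero}  le = le id
∑ₚ-mono {suc m} le = ∑-mono (λ j → ∑ₚ-mono (λ ρ → le (extend j ρ)))

∑ₚ≢0⇒ : ∀ {n} (F : Perm n → ℕ) → ∑ₚ F ≢ 0 → ∃ λ p → F p ≢ 0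
∑ₚ≢0⇒ {zero}  F ne = id , ne
∑ₚ≢0⇒ {suc m} F ne with ∑≢0⇒ _ ne
... | j , ne′ with ∑ₚ≢0⇒ (λ ρ → F (extend j ρ)) ne′
...   | ρ , ne″ = extend j ρ , ne″

-- The enumeration lists every permutation exactly once (up to ≈).
∑ₚ-δ : ∀ {n} (p : Perm n) → ∑ₚ (λ q → 𝟙 (p ≈? q)) ≡ 1
∑ₚ-δ {zero}  p = 𝟙-yes (λ ()) (p ≈? id)
∑ₚ-δ {suc m} p = trans (sum-cong-≗ column) (∑-δ₁ (p ⟨$⟩ʳ zero))
  where
  r = remove zero p
  split : ∀ j ρ → 𝟙 (p ≈? extend j ρ) ≡ 𝟙 (p ⟨$⟩ʳ zero ≟ j) * 𝟙 (r ≈? ρ)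
  split j ρ = trans (𝟙-cong (p ≈? extend j ρ) ((p ⟨$⟩ʳ zero ≟ j) ×-dec (r ≈? ρ))
                            (Equivalence.to unique) (Equivalence.from unique))
                    (𝟙-× (p ⟨$⟩ʳ zero ≟ j) (r ≈? ρ))
    where unique = extend-unique p j ρ
  column : ∀ j → ∑ₚ (λ ρ → 𝟙 (p ≈? extend j ρ)) ≡ 𝟙 (p ⟨$⟩ʳ zero ≟ j)
  column j = begin
    ∑ₚ (λ ρ → 𝟙 (p ≈? extend j ρ))                ≡⟨ ∑ₚ-cong (split j) ⟩
    ∑ₚ (λ ρ → 𝟙 (p ⟨$⟩ʳ zero ≟ j) * 𝟙 (r ≈? ρ))   ≡⟨ ∑ₚ-*ˡ (𝟙 (p ⟨$⟩ʳ zero ≟ j)) (λ ρ → 𝟙 (r ≈? ρ)) ⟩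
    𝟙 (p ⟨$⟩ʳ zero ≟ j) * ∑ₚ (λ ρ → 𝟙 (r ≈? ρ))   ≡⟨ cong (𝟙 (p ⟨$⟩ʳ zero ≟ j) *_) (∑ₚ-δ r) ⟩
    𝟙 (p ⟨$⟩ʳ zero ≟ j) * 1                       ≡⟨ *-identityʳ _ ⟩
    𝟙 (p ⟨$⟩ʳ zero ≟ j)                           ∎
    where open ≡-Reasoning

∑ₚ-pick : ∀ {n} {F : Perm n → ℕ} → F Preserves _≈_ ⟶ _≡_ →
  ∀ p → ∑ₚ (λ q → 𝟙 (p ≈? q) * F q) ≡ F p
∑ₚ-pick {F = F} resp p = begin
  ∑ₚ (λ q → 𝟙 (p ≈? q) * F q)   ≡⟨ ∑ₚ-cong (λ q → 𝟙-guard (p ≈? q) (λ p≈q → resp (≈-sym {p = p} {q} p≈q))) ⟩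
  ∑ₚ (λ q → 𝟙 (p ≈? q) * F p)   ≡⟨ ∑ₚ-cong (λ q → *-comm (𝟙 (p ≈? q)) (F p)) ⟩
  ∑ₚ (λ q → F p * 𝟙 (p ≈? q))   ≡⟨ ∑ₚ-*ˡ (F p) (λ q → 𝟙 (p ≈? q)) ⟩
  F p * ∑ₚ (λ q → 𝟙 (p ≈? q))   ≡⟨ cong (F p *_) (∑ₚ-δ p) ⟩
  F p * 1                       ≡⟨ *-identityʳ (F p) ⟩
  F p                           ∎
  where open ≡-Reasoning

≤∑ₚ : ∀ {n} {F : Perm n → ℕ} → F Preserves _≈_ ⟶ _≡_ → ∀ p → F p ≤ ∑ₚ F
≤∑ₚ {F = F} resp p =
  subst (_≤ ∑ₚ F) (∑ₚ-pick resp p) (∑ₚ-mono (λ q → 𝟙*-≤ (p ≈? q) (F q)))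

∑ₚ≡0⇒ : ∀ {n} {F : Perm n → ℕ} → F Preserves _≈_ ⟶ _≡_ →
  ∑ₚ F ≡ 0 → ∀ p → F p ≡ 0
∑ₚ≡0⇒ resp e p = n≤0⇒n≡0 (subst (_ ≤_) e (≤∑ₚ resp p))

∑ₚ-translate : ∀ {n} (s : Perm n) {F : Perm n → ℕ} → F Preserves _≈_ ⟶ _≡_ →
  ∑ₚ (λ g → F (s ∘ₚ g)) ≡ ∑ₚ F
∑ₚ-translate s {F} resp = begin
  ∑ₚ (λ g → F (s ∘ₚ g))                               ≡⟨ ∑ₚ-cong (λ g → sym (∑ₚ-pick resp (s ∘ₚ g))) ⟩
  ∑ₚ (λ g → ∑ₚ (λ h → 𝟙 (s ∘ₚ g ≈? h) * F h))         ≡⟨ ∑ₚ-comm (λ g h → 𝟙 (s ∘ₚ g ≈? h) * F h) ⟩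
  ∑ₚ (λ h → ∑ₚ (λ g → 𝟙 (s ∘ₚ g ≈? h) * F h))         ≡⟨ ∑ₚ-cong (λ h → ∑ₚ-cong (λ g → swap h g)) ⟩
  ∑ₚ (λ h → ∑ₚ (λ g → F h * 𝟙 (flip s ∘ₚ h ≈? g)))    ≡⟨ ∑ₚ-cong (λ h → ∑ₚ-*ˡ (F h) (λ g → 𝟙 (flip s ∘ₚ h ≈? g))) ⟩
  ∑ₚ (λ h → F h * ∑ₚ (λ g → 𝟙 (flip s ∘ₚ h ≈? g)))    ≡⟨ ∑ₚ-cong (λ h → cong (F h *_) (∑ₚ-δ (flip s ∘ₚ h))) ⟩
  ∑ₚ (λ h → F h * 1)                                  ≡⟨ ∑ₚ-cong (λ h → *-identityʳ (F h)) ⟩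
  ∑ₚ F                                                ∎
  where
  open ≡-Reasoning
  -- s ∘ₚ g ≈ h  iff  s⁻¹ ∘ₚ h ≈ g
  swap : ∀ h g → 𝟙 (s ∘ₚ g ≈? h) * F h ≡ F h * 𝟙 (flip s ∘ₚ h ≈? g)
  swap h g = trans (cong (_* F h) (𝟙-cong (s ∘ₚ g ≈? h) (flip s ∘ₚ h ≈? g)
      (λ e x → trans (sym (e (s ⟨$⟩ˡ x))) (cong (g ⟨$⟩ʳ_) (inverseʳ s)))
      (λ e x → trans (sym (e (s ⟨$⟩ʳ x))) (cong (h ⟨$⟩ʳ_) (inverseˡ s)))))
    (*-comm _ (F h))

∑ₚ-squeeze : ∀ {n} {F F′ : Perm n → ℕ} →
  F Preserves _≈_ ⟶ _≡_ → F′ Preserves _≈_ ⟶ _≡_ →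
  (∀ p → F p ≤ F′ p) → ∑ₚ F′ ≡ ∑ₚ F → ∀ p → F′ p ≡ F p
∑ₚ-squeeze {F = F} {F′} resp resp′ le total p =
  ≤-antisym (m∸n≡0⇒m≤n (∑ₚ≡0⇒ gap-resp gap≡0 p)) (le p)
  where
  gap : Perm _ → ℕ
  gap q = F′ q ∸ F q
  gap-resp : gap Preserves _≈_ ⟶ _≡_
  gap-resp e = cong₂ _∸_ (resp′ e) (resp e)
  gap≡0 : ∑ₚ gap ≡ 0
  gap≡0 = +-cancelˡ-≡ (∑ₚ F) _ _ (begin
    ∑ₚ F + ∑ₚ gap              ≡⟨ sym (∑ₚ-+ F gap) ⟩
    ∑ₚ (λ q → F q + gap q)     ≡⟨ ∑ₚ-cong (λ q → m+[n∸m]≡n (le q)) ⟩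
    ∑ₚ F′                      ≡⟨ total ⟩
    ∑ₚ F                       ≡⟨ sym (+-identityʳ _) ⟩
    ∑ₚ F + 0                   ∎)
    where open ≡-Reasoning

search : ∀ {n} (P : Perm n → Set) → Decidable P → P Respects _≈_ →
  (∃ P) ⊎ (∀ p → ¬ P p)
search P P? resp with ∑ₚ (λ p → 𝟙 (P? p)) ≟ℕ 0
... | yes none = inj₂ (λ p → 𝟙≡0⇒¬ (P? p) (∑ₚ≡0⇒ 𝟙P-resp none p))
  where
  𝟙P-resp : (λ p → 𝟙 (P? p)) Preserves _≈_ ⟶ _≡_
  𝟙P-resp {p} {q} e = 𝟙-cong (P? p) (P? q) (resp e) (resp (≈-sym {p = p} {q} e))
... | no some with ∑ₚ≢0⇒ (λ p → 𝟙 (P? p)) some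
...   | p , ne = inj₁ (p , 𝟙≢0⇒ (P? p) ne)

∑ₚ-zero : ∀ {n} → ∑ₚ {n} (λ _ → 0) ≡ 0
∑ₚ-zero {n} = ∑ₚ-*ˡ {n} 0 (λ _ → 0)

-- ∑⟨ w ⟩ F sums F over Sym(n) with weights w; with w the indicator of a
-- group K this is the sum of F over K.
∑⟨_⟩ : ∀ {n} → (Perm n → ℕ) → (Perm n → ℕ) → ℕ
∑⟨ w ⟩ F = ∑ₚ (λ g → w g * F g)

∑⟨⟩-cong : ∀ {n} (w : Perm n → ℕ) {F F′ : Perm n → ℕ} →
  (∀ g → F g ≡ F′ g) → ∑⟨ w ⟩ F ≡ ∑⟨ w ⟩ F′
∑⟨⟩-cong w e = ∑ₚ-cong (λ g → cong (w g *_) (e g))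

∑⟨⟩-1 : ∀ {n} (w : Perm n → ℕ) → ∑⟨ w ⟩ (λ _ → 1) ≡ ∑ₚ w
∑⟨⟩-1 w = ∑ₚ-cong (λ g → *-identityʳ (w g))

∑⟨⟩-*ˡ : ∀ {n} (w : Perm n → ℕ) (c : ℕ) (F : Perm n → ℕ) →
  ∑⟨ w ⟩ (λ g → c * F g) ≡ c * ∑⟨ w ⟩ F
∑⟨⟩-*ˡ w c F = trans (∑ₚ-cong (λ g → x∙yz≈y∙xz (w g) c (F g))) (∑ₚ-*ˡ c (λ g → w g * F g))

∑⟨⟩-∑ : ∀ {n k} (w : Perm n → ℕ) (M : Perm n → Fin k → ℕ) →
  ∑⟨ w ⟩ (λ g → ∑[ x < k ] M g x) ≡ ∑[ x < k ] ∑⟨ w ⟩ (λ g → M g x)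
∑⟨⟩-∑ w M =
  trans (∑ₚ-cong (λ g → *-distribˡ-sum (w g) (M g))) (∑ₚ-∑ (λ g x → w g * M g x))

∑⟨⟩-∑∑ : ∀ {n k l} (w : Perm n → ℕ) (c : Fin k → Fin l → ℕ)
  (M : Perm n → Fin k → Fin l → ℕ) →
  ∑⟨ w ⟩ (λ g → ∑[ x < k ] ∑[ y < l ] (c x y * M g x y))
    ≡ ∑[ x < k ] ∑[ y < l ] (c x y * ∑⟨ w ⟩ (λ g → M g x y))
∑⟨⟩-∑∑ w c M = trans (∑⟨⟩-∑ w (λ g x → ∑[ y < _ ] (c x y * M g x y)))
  (sum-cong-≗ (λ x → trans (∑⟨⟩-∑ w (λ g y → c x y * M g x y))
    (sum-cong-≗ (λ y → ∑⟨⟩-*ˡ w (c x y) (λ g → M g x y)))))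

∑⟨⟩-difference : ∀ {n} {wG wH wS : Perm n → ℕ} (F : Perm n → ℕ) →
  (∀ g → wG g ≡ wH g + wS g) →
  ∑⟨ wG ⟩ F ≡ ∑ₚ wG → ∑⟨ wH ⟩ F ≡ ∑ₚ wH → ∑⟨ wS ⟩ F ≡ ∑ₚ wS
∑⟨⟩-difference {wG = wG} {wH} {wS} F split eqG eqH = +-cancelˡ-≡ (∑ₚ wH) _ _ (begin
  ∑ₚ wH + ∑⟨ wS ⟩ F                      ≡⟨ cong (_+ ∑⟨ wS ⟩ F) (sym eqH) ⟩
  ∑⟨ wH ⟩ F + ∑⟨ wS ⟩ F                  ≡⟨ sym (∑ₚ-+ (λ g → wH g * F g) (λ g → wS g * F g)) ⟩
  ∑ₚ (λ g → wH g * F g + wS g * F g)     ≡⟨ ∑ₚ-cong (λ g → trans (sym (*-distribʳ-+ (F g) (wH g) (wS g)))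
                                                               (cong (_* F g) (sym (split g)))) ⟩
  ∑⟨ wG ⟩ F                              ≡⟨ eqG ⟩
  ∑ₚ wG                                  ≡⟨ ∑ₚ-cong split ⟩
  ∑ₚ (λ g → wH g + wS g)                 ≡⟨ ∑ₚ-+ wH wS ⟩
  ∑ₚ wH + ∑ₚ wS                          ∎)
  where open ≡-Reasoning

sends : ∀ {n} → Perm n → Fin n → Fin n → ℕ
sends g x u = 𝟙 (g ⟨$⟩ʳ x ≟ u)

sends-resp : ∀ {n} (x u : Fin n) → (λ g → sends g x u) Preserves _≈_ ⟶ _≡_
sends-resp x u {g} {h} e =
  𝟙-cong (g ⟨$⟩ʳ x ≟ u) (h ⟨$⟩ʳ x ≟ u) (trans (sym (e x))) (trans (e x))

fix : ∀ {n} → Perm n → ℕ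
fix {n} g = ∑[ x < n ] sends g x x

fix₂ : ∀ {n} → Perm n → ℕ
fix₂ {n} g = ∑[ x < n ] ∑[ y < n ] (𝟙 (¬? (x ≟ y)) * (sends g x x * sends g y y))

fix-resp : ∀ {n} → fix {n} Preserves _≈_ ⟶ _≡_
fix-resp {n} {g} {h} e = sum-cong-≗ (λ x → sends-resp x x {g} {h} e)

fix≡0⇒derangement : ∀ {n} (g : Perm n) → fix g ≡ 0 → Derangement g
fix≡0⇒derangement g e x = 𝟙≡0⇒¬ (g ⟨$⟩ʳ x ≟ x) (∑≡0⇒ (λ y → sends g y y) e x)

-- fix₂ g = fix g * (fix g - 1): a pair of fixed points is either a pair of
-- distinct fixed points or a diagonal pair (x, x).
fix₂+fix : ∀ {n} (g : Perm n) → fix₂ g + fix g ≡ fix g * fix g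
fix₂+fix {n} g = sym (begin
  fix g * fix g
    ≡⟨ *-distribʳ-sum (fix g) f ⟩
  ∑[ x < n ] (f x * fix g)
    ≡⟨ sum-cong-≗ (λ x → *-distribˡ-sum (f x) f) ⟩
  ∑[ x < n ] ∑[ y < n ] (f x * f y)
    ≡⟨ sum-cong-≗ (λ x → sum-cong-≗ (λ y → sym (𝟙-split (x ≟ y) (f x * f y)))) ⟩
  ∑[ x < n ] ∑[ y < n ] (distinct x y + diagonal x y)
    ≡⟨ sum-cong-≗ (λ x → ∑-distrib-+ (distinct x) (diagonal x)) ⟩
  ∑[ x < n ] (∑[ y < n ] distinct x y + ∑[ y < n ] diagonal x y)
    ≡⟨ ∑-distrib-+ (λ x → ∑[ y < n ] distinct x y) (λ x → ∑[ y < n ] diagonal x y) ⟩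
  fix₂ g + ∑[ x < n ] ∑[ y < n ] diagonal x y
    ≡⟨ cong (fix₂ g +_) (sum-cong-≗ (λ x → trans (∑-δ x (λ y → f x * f y))
                                                 (𝟙-idem (g ⟨$⟩ʳ x ≟ x)))) ⟩
  fix₂ g + fix g ∎)
  where
  open ≡-Reasoning
  f : Fin n → ℕ
  f x = sends g x x
  distinct diagonal : Fin n → Fin n → ℕ
  distinct x y = 𝟙 (¬? (x ≟ y)) * (f x * f y)
  diagonal x y = 𝟙 (x ≟ y) * (f x * f y)

𝟙∈ : ∀ {n} → PermGroup n → Perm n → ℕ
𝟙∈ K g = 𝟙 (∈-dec K g)

𝟙∈-resp : ∀ {n} (K : PermGroup n) → 𝟙∈ K Preserves _≈_ ⟶ _≡_
𝟙∈-resp K {g} {h} e =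
  𝟙-cong (∈-dec K g) (∈-dec K h) (∈-resp K e) (∈-resp K (≈-sym {p = g} {h} e))

𝟙∈-translate : ∀ {n} (K : PermGroup n) {s} → s ∈ K → ∀ g → 𝟙∈ K (s ∘ₚ g) ≡ 𝟙∈ K g
𝟙∈-translate K {s} s∈K g = 𝟙-cong (∈-dec K (s ∘ₚ g)) (∈-dec K g)
  (λ sg∈K → ∈-resp K (λ x → cong (g ⟨$⟩ʳ_) (inverseʳ s)) (∘-∈ K (inv-∈ K s∈K) sg∈K))
  (∘-∈ K s∈K)

∑∈-translate : ∀ {n} (K : PermGroup n) {s} → s ∈ K →
  {F : Perm n → ℕ} → F Preserves _≈_ ⟶ _≡_ →
  ∑⟨ 𝟙∈ K ⟩ (λ g → F (s ∘ₚ g)) ≡ ∑⟨ 𝟙∈ K ⟩ F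
∑∈-translate K {s} s∈K {F} resp =
  trans (∑ₚ-cong (λ g → cong (_* F (s ∘ₚ g)) (sym (𝟙∈-translate K s∈K g))))
        (∑ₚ-translate s (λ {g} {h} e → cong₂ _*_ (𝟙∈-resp K e) (resp e)))

another-point : ∀ {n} {a b : Fin n} → a ≢ b → ∀ x → ∃ λ y → x ≢ y
another-point {a = a} {b} a≢b x with x ≟ a
... | yes x≡a = b , λ x≡b → a≢b (trans (sym x≡a) x≡b)
... | no  x≢a = a , x≢a

transitive : ∀ {n} (K : PermGroup n) → TwoTransitive K →
  ∀ {a b : Fin n} → a ≢ b → ∀ x u → ∃ λ s → s ∈ K × s ⟨$⟩ʳ x ≡ u
transitive K 2tr a≢b x u
  with another-point a≢b x | another-point a≢b u
... | x′ , x≢x′ | u′ , u≢u′ with 2tr x x′ u u′ x≢x′ u≢u′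
...   | s , s∈K , sx≡u , _ = s , s∈K , sx≡u

module TwoTransitiveCounting {n} (K : PermGroup n) (2tr : TwoTransitive K)
                             {a b : Fin n} (a≢b : a ≢ b) where

  -- Counting pairs (g, x) with g x = x: every point x is the image of a.
  ∑fix≡order : ∑⟨ 𝟙∈ K ⟩ fix ≡ ∑ₚ (𝟙∈ K)
  ∑fix≡order = begin
    ∑⟨ 𝟙∈ K ⟩ fix                               ≡⟨ ∑⟨⟩-∑ (𝟙∈ K) (λ g x → sends g x x) ⟩
    ∑[ x < n ] ∑⟨ 𝟙∈ K ⟩ (λ g → sends g x x)    ≡⟨ sum-cong-≗ from-a ⟨
    ∑[ x < n ] ∑⟨ 𝟙∈ K ⟩ (λ g → sends g a x)    ≡⟨ ∑⟨⟩-∑ (𝟙∈ K) (λ g x → sends g a x) ⟨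
    ∑⟨ 𝟙∈ K ⟩ (λ g → ∑[ x < n ] sends g a x)    ≡⟨ ∑⟨⟩-cong (𝟙∈ K) (λ g → ∑-δ₁ (g ⟨$⟩ʳ a)) ⟩
    ∑⟨ 𝟙∈ K ⟩ (λ _ → 1)                         ≡⟨ ∑⟨⟩-1 (𝟙∈ K) ⟩
    ∑ₚ (𝟙∈ K)                                   ∎
    where
    open ≡-Reasoning
    from-a : ∀ x → ∑⟨ 𝟙∈ K ⟩ (λ g → sends g a x) ≡ ∑⟨ 𝟙∈ K ⟩ (λ g → sends g x x)
    from-a x with transitive K 2tr a≢b a x
    ... | s , s∈K , sa≡x =
      trans (sym (∑∈-translate K s∈K {λ g → sends g a x} (λ {g} {h} → sends-resp a x {g} {h})))
            (cong (λ z → ∑⟨ 𝟙∈ K ⟩ (λ g → sends g z x)) sa≡x)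

  -- Counting pairs (g, (x, y)) with x ≢ y fixed by g: every such pair is
  -- the image of (a, b).
  ∑fix₂≡order : ∑⟨ 𝟙∈ K ⟩ fix₂ ≡ ∑ₚ (𝟙∈ K)
  ∑fix₂≡order = begin
    ∑⟨ 𝟙∈ K ⟩ fix₂
      ≡⟨ ∑⟨⟩-∑∑ (𝟙∈ K) distinct (λ g x y → sends g x x * sends g y y) ⟩
    ∑[ x < n ] ∑[ y < n ] (distinct x y * ∑⟨ 𝟙∈ K ⟩ (λ g → sends g x x * sends g y y))
      ≡⟨ sum-cong-≗ (λ x → sum-cong-≗ (λ y → 𝟙-guard (¬? (x ≟ y)) (from-ab x y))) ⟨
    ∑[ x < n ] ∑[ y < n ] (distinct x y * ∑⟨ 𝟙∈ K ⟩ (λ g → sends g a x * sends g b y))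
      ≡⟨ ∑⟨⟩-∑∑ (𝟙∈ K) distinct (λ g x y → sends g a x * sends g b y) ⟨
    ∑⟨ 𝟙∈ K ⟩ (λ g → ∑[ x < n ] ∑[ y < n ] (distinct x y * (sends g a x * sends g b y)))
      ≡⟨ ∑⟨⟩-cong (𝟙∈ K) (λ g → ∑-distinct-pair (images-distinct g)) ⟩
    ∑⟨ 𝟙∈ K ⟩ (λ _ → 1)
      ≡⟨ ∑⟨⟩-1 (𝟙∈ K) ⟩
    ∑ₚ (𝟙∈ K) ∎
    where
    open ≡-Reasoning
    distinct : Fin n → Fin n → ℕ
    distinct x y = 𝟙 (¬? (x ≟ y))
    from-ab : ∀ x y → x ≢ y →
      ∑⟨ 𝟙∈ K ⟩ (λ g → sends g a x * sends g b y) ≡ ∑⟨ 𝟙∈ K ⟩ (λ g → sends g x x * sends g y y)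
    from-ab x y x≢y with 2tr a b x y a≢b x≢y
    ... | s , s∈K , sa≡x , sb≡y =
      trans (sym (∑∈-translate K s∈K {λ g → sends g a x * sends g b y}
                   (λ {g} {h} e → cong₂ _*_ (sends-resp a x {g} {h} e) (sends-resp b y {g} {h} e))))
            (cong₂ (λ z w → ∑⟨ 𝟙∈ K ⟩ (λ g → sends g z x * sends g w y)) sa≡x sb≡y)
    images-distinct : ∀ (g : Perm n) → g ⟨$⟩ʳ a ≢ g ⟨$⟩ʳ b
    images-distinct g e = a≢b (trans (sym (inverseˡ g)) (trans (cong (g ⟨$⟩ˡ_) e) (inverseˡ g)))

module _ {n} {H G : PermGroup n} (H⊆G : H ⊆ G) where

  Outside : Perm n → Set
  Outside g = g ∈ G × g ∉ H

  outside? : Decidable Outside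
  outside? g = ∈-dec G g ×-dec ¬? (∈-dec H g)

  outside-resp : Outside Respects _≈_
  outside-resp {g} {h} e (g∈G , g∉H) =
    ∈-resp G e g∈G , λ h∈H → g∉H (∈-resp H (≈-sym {p = g} {h} e) h∈H)

  𝟙out : Perm n → ℕ
  𝟙out g = 𝟙 (outside? g)

  𝟙out-resp : 𝟙out Preserves _≈_ ⟶ _≡_
  𝟙out-resp {g} {h} e = 𝟙-cong (outside? g) (outside? h)
    (outside-resp {g} {h} e) (outside-resp {h} {g} (≈-sym {p = g} {h} e))

  𝟙∈-split : ∀ g → 𝟙∈ G g ≡ 𝟙∈ H g + 𝟙out g
  𝟙∈-split g with ∈-dec G g | ∈-dec H g
  ... | yes _   | yes _   = refl
  ... | yes _   | no  _   = refl
  ... | no  g∉G | yes g∈H = ⊥-elim (g∉G (H⊆G g g∈H))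
  ... | no  _   | no  _   = refl

  derangement-outside : TwoTransitive H → TwoTransitive G →
    {a b : Fin n} → a ≢ b → ∀ g₀ → Outside g₀ →
    ∃ λ g → Outside g × Derangement g
  derangement-outside 2trH 2trG a≢b g₀ out₀
    with search (λ g → Outside g × Derangement g)
                (λ g → outside? g ×-dec all? (λ x → ¬? (g ⟨$⟩ʳ x ≟ x)))
                (λ {g} {h} e (out , der) → outside-resp {g} {h} e out , λ x hx → der x (trans (e x) hx))
  ... | inj₁ found = found
  ... | inj₂ none = ⊥-elim (𝟙≡0⇒¬ (outside? g₀) (∑ₚ≡0⇒ 𝟙out-resp |G∖H|≡0 g₀) out₀)
    where
    module CH = TwoTransitiveCounting H 2trH a≢b
    module CG = TwoTransitiveCounting G 2trG a≢b

    ∑fix : ∑⟨ 𝟙out ⟩ fix ≡ ∑ₚ 𝟙out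
    ∑fix = ∑⟨⟩-difference fix 𝟙∈-split CG.∑fix≡order CH.∑fix≡order

    ∑fix₂ : ∑⟨ 𝟙out ⟩ fix₂ ≡ ∑ₚ 𝟙out
    ∑fix₂ = ∑⟨⟩-difference fix₂ 𝟙∈-split CG.∑fix₂≡order CH.∑fix₂≡order

    fix≥1 : ∀ g → Outside g → 1 ≤ fix g
    fix≥1 g out = n≢0⇒n>0 (λ fix≡0 → none g (out , fix≡0⇒derangement g fix≡0))

    fix≡1 : ∀ g → Outside g → fix g ≡ 1
    fix≡1 g out = 𝟙-cancel (outside? g) out
      (∑ₚ-squeeze {F = λ h → 𝟙out h * 1} {F′ = λ h → 𝟙out h * fix h}
        (λ {h} {h′} e → cong (_* 1) (𝟙out-resp e))
        (λ {h} {h′} e → cong₂ _*_ (𝟙out-resp e) (fix-resp {n} {h} {h′} e))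
        (λ h → 𝟙-guard-≤ (outside? h) (fix≥1 h))
        (trans ∑fix (sym (∑⟨⟩-1 𝟙out)))
        g)

    fix₂≡0 : ∀ g → Outside g → fix₂ g ≡ 0
    fix₂≡0 g out = +-cancelʳ-≡ 1 (fix₂ g) 0 (begin
      fix₂ g + 1          ≡⟨ cong (fix₂ g +_) (sym (fix≡1 g out)) ⟩
      fix₂ g + fix g      ≡⟨ fix₂+fix g ⟩
      fix g * fix g       ≡⟨ cong (λ k → k * k) (fix≡1 g out) ⟩
      1                   ∎)
      where open ≡-Reasoning

    |G∖H|≡0 : ∑ₚ 𝟙out ≡ 0
    |G∖H|≡0 = begin
      ∑ₚ 𝟙out                     ≡⟨ ∑fix₂ ⟨
      ∑⟨ 𝟙out ⟩ fix₂              ≡⟨ ∑ₚ-cong (λ g → 𝟙-guard (outside? g) (fix₂≡0 g)) ⟩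
      ∑ₚ (λ g → 𝟙out g * 0)       ≡⟨ ∑ₚ-cong (λ g → *-zeroʳ (𝟙out g)) ⟩
      ∑ₚ {n} (λ _ → 0)            ≡⟨ ∑ₚ-zero {n} ⟩
      0                           ∎
      where open ≡-Reasoning

perm₁-trivial : (g : Perm 1) → id ≈ g
perm₁-trivial g zero with g ⟨$⟩ʳ zero
... | zero = refl

lemma4p2 : (n : ℕ) (H G : PermGroup n) →
    TwoTransitive H → TwoTransitive G → H ⊂ G →
    ∃ λ g → g ∈ G × g ∉ H × Derangement g
-- With no points, every permutation is a derangement.
lemma4p2 zero H G _ _ (_ , g₀ , g₀∈G , g₀∉H) = g₀ , g₀∈G , g₀∉H , λ ()
-- With one point, G is trivial and cannot properly contain H.
lemma4p2 (suc zero) H G _ _ (_ , g₀ , _ , g₀∉H) =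
  ⊥-elim (g₀∉H (∈-resp H (perm₁-trivial g₀) (id-∈ H)))
lemma4p2 (suc (suc m)) H G 2trH 2trG (H⊆G , g₀ , out₀)
  with derangement-outside {H = H} {G} H⊆G 2trH 2trG {zero} {suc zero} (λ ()) g₀ out₀
... | g , (g∈G , g∉H) , der = g , g∈G , g∉H , der
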